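{- For every integer $n\ge 4$, $$ \sum_{l=0}^3(-1)^l\binom{3}{l}\sum_{\substack{j_1+j_2+j_3=n-2 l\\ j_1, j_2, j_3\ge 1}}B_{j_1}B_{j_2}B_{j_3} =\binom{n-1}{2}B_{n-2}-\binom{n-4}{2}B_{n-4}\,. $$
   Context: The balancing numbers $B_n$ are defined by $B_0=0$, $B_1=1$ and $B_n=6B_{n-1}-B_{n-2}$ for $n\ge 2$. The inner sum runs over all ordered triples of positive integers with the indicated sum (it is empty, hence $0$, if no such triple exists). -}

module Defs where

open import Data.Nat as ℕ using (ℕ; zero; suc; _∸_; _≤ᵇ_)
open import Data.Integer using (ℤ; +_; _+_; _-_; _*_; -_; 0ℤ)
open import Data.List using (List; map; sum; filter; concatMap)
open import Data.List.Base using (upTo)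
open import Data.Bool using (if_then_else_)

B : ℕ → ℤ
B zero = + 0
B (suc zero) = + 1
B (suc (suc n)) = + 6 * B (suc n) - B n

Σ₁ : ℕ → (ℕ → ℤ) → ℤ
Σ₁ zero f = + 0
Σ₁ (suc m) f = Σ₁ m f + f (suc m)

-- Sum over ordered triples (j₁ , j₂ , j₃) of positive integers with
-- j₁ + j₂ + j₃ = m of B j₁ * B j₂ * B j₃.  For j₁, j₂ ≥ 1 the third
-- entry is determined: j₃ = m - j₁ - j₂, and it must satisfy j₃ ≥ 1,
-- i.e. j₁ + j₂ + 1 ≤ m.
tripleSum : ℕ → ℤ
tripleSum m =
  Σ₁ m (λ j₁ → Σ₁ m (λ j₂ →
    if (suc (j₁ ℕ.+ j₂)) ≤ᵇ m
    then B j₁ * B j₂ * B (m ∸ j₁ ∸ j₂)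
    else + 0))

-- The triple sum is T = B ⋆ S with S = B ⋆ B (Cauchy convolution). Write
-- defect u k = u (k+2) - 6 u (k+1) + u k. Convolving with a sequence a commutes
-- with the defect up to the boundary term a (k+1) b 1, so defect B = 0 gives
-- defect S k = B (k+1) and then defect T k = S (k+1). A sequence is determined by
-- two initial values and its defect, which yields the closed forms
--   16 S k = k B (k+1) - 3 (k+1) B k,   512 T k = (8k² + 27k + 19) B k - 9k B (k+1),
-- and the theorem becomes a polynomial identity in B m and B (m+1).

module Submission where

open import Defs
open import Data.Bool using (true; false; if_then_else_)
open import Data.Nat as ℕ using (ℕ; zero; suc; _≤_; _<_; _∸_; _≤ᵇ_; s≤s)
import Data.Nat.Properties as ℕₚ
open import Data.Nat.Combinatorics using (_C_; nC1≡n; nCk+nC[k+1]≡[n+1]C[k+1])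
import Data.Nat.Tactic.RingSolver as ℕ-Solver
open import Data.Integer using (ℤ; +_; _+_; _-_; _*_; -_)
import Data.Integer.Properties as ℤₚ
open import Data.Integer.Tactic.RingSolver using (solve-∀)
open import Algebra.Properties.CommutativeSemigroup ℤₚ.+-commutativeSemigroup using (interchange)
open import Data.Product using (_×_; _,_; proj₁)
open import Data.Sum using (inj₁; inj₂)
open import Function using (_∘_)
open import Relation.Nullary.Reflects using (ofⁿ)
open import Relation.Binary.PropositionalEquality
  using (_≡_; refl; sym; trans; cong; cong₂; module ≡-Reasoning)

open ≡-Reasoning

Σ₁-cong : ∀ m {f g : ℕ → ℤ} → (∀ {j} → j ≤ m → f j ≡ g j) → Σ₁ m f ≡ Σ₁ m g
Σ₁-cong zero    f≗g = refl
Σ₁-cong (suc m) f≗g = cong₂ _+_ (Σ₁-cong m (f≗g ∘ ℕₚ.m≤n⇒m≤1+n)) (f≗g ℕₚ.≤-refl)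

Σ₁-zero : ∀ m {f : ℕ → ℤ} → (∀ j → f j ≡ + 0) → Σ₁ m f ≡ + 0
Σ₁-zero zero    f≗0 = refl
Σ₁-zero (suc m) f≗0 = cong₂ _+_ (Σ₁-zero m f≗0) (f≗0 (suc m))

Σ₁-extend : ∀ {m n} {f : ℕ → ℤ} → m ≤ n → (∀ {j} → m < j → f j ≡ + 0) → Σ₁ n f ≡ Σ₁ m f
Σ₁-extend {n = zero}  ℕ.z≤n _ = refl
Σ₁-extend {n = suc n} m≤1+n f≗0 with ℕₚ.m≤n⇒m<n∨m≡n m≤1+n
... | inj₂ refl        = refl
... | inj₁ (s≤s m≤n) =
  trans (cong₂ _+_ (Σ₁-extend m≤n f≗0) (f≗0 (s≤s m≤n))) (ℤₚ.+-identityʳ _)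

Σ₁-distrib-+ : ∀ m (f g : ℕ → ℤ) → Σ₁ m (λ j → f j + g j) ≡ Σ₁ m f + Σ₁ m g
Σ₁-distrib-+ zero    f g = refl
Σ₁-distrib-+ (suc m) f g =
  trans (cong (_+ (f (suc m) + g (suc m))) (Σ₁-distrib-+ m f g))
        (interchange (Σ₁ m f) (Σ₁ m g) (f (suc m)) (g (suc m)))

Σ₁-distrib-neg : ∀ m (f : ℕ → ℤ) → Σ₁ m (λ j → - f j) ≡ - Σ₁ m f
Σ₁-distrib-neg zero    f = refl
Σ₁-distrib-neg (suc m) f =
  trans (cong (_- f (suc m)) (Σ₁-distrib-neg m f)) (sym (ℤₚ.neg-distrib-+ (Σ₁ m f) (f (suc m))))

Σ₁-distrib-- : ∀ m (f g : ℕ → ℤ) → Σ₁ m (λ j → f j - g j) ≡ Σ₁ m f - Σ₁ m g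
Σ₁-distrib-- m f g = trans (Σ₁-distrib-+ m f (-_ ∘ g)) (cong (λ s → Σ₁ m f + s) (Σ₁-distrib-neg m g))

Σ₁-*ˡ : ∀ m c (f : ℕ → ℤ) → Σ₁ m (λ j → c * f j) ≡ c * Σ₁ m f
Σ₁-*ˡ zero    c f = sym (ℤₚ.*-zeroʳ c)
Σ₁-*ˡ (suc m) c f =
  trans (cong (_+ c * f (suc m)) (Σ₁-*ˡ m c f)) (sym (ℤₚ.*-distribˡ-+ c (Σ₁ m f) (f (suc m))))

-- Cauchy convolution; the term j = 0 is omitted since all sequences here vanish at 0.
_⋆_ : (ℕ → ℤ) → (ℕ → ℤ) → ℕ → ℤ
(a ⋆ b) k = Σ₁ k (λ j → a j * b (k ∸ j))

⋆-congʳ : ∀ a {b c : ℕ → ℤ} k → (∀ t → b t ≡ c t) → (a ⋆ b) k ≡ (a ⋆ c) k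
⋆-congʳ a k b≗c = Σ₁-cong k (λ {j} _ → cong (a j *_) (b≗c (k ∸ j)))

⋆-zeroʳ : ∀ a {b : ℕ → ℤ} k → (∀ t → b t ≡ + 0) → (a ⋆ b) k ≡ + 0
⋆-zeroʳ a k b≗0 = Σ₁-zero k (λ j → trans (cong (a j *_) (b≗0 (k ∸ j))) (ℤₚ.*-zeroʳ (a j)))

⋆-extend : ∀ a (b : ℕ → ℤ) {k n} → b 0 ≡ + 0 → k ≤ n →
           Σ₁ n (λ j → a j * b (k ∸ j)) ≡ (a ⋆ b) k
⋆-extend a b b₀≡0 k≤n = Σ₁-extend k≤n λ {j} k<j → begin
  a j * b (_ ∸ j) ≡⟨ cong (λ t → a j * b t) (ℕₚ.m≤n⇒m∸n≡0 (ℕₚ.<⇒≤ k<j)) ⟩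
  a j * b 0       ≡⟨ cong (a j *_) b₀≡0 ⟩
  a j * + 0       ≡⟨ ℤₚ.*-zeroʳ (a j) ⟩
  + 0             ∎

⋆-suc : ∀ a b k → (a ⋆ b) (suc k) ≡ (a ⋆ (b ∘ suc)) k + a (suc k) * b 0
⋆-suc a b k =
  cong₂ _+_ (Σ₁-cong k (λ {j} j≤k → cong (λ t → a j * b t) (ℕₚ.+-∸-assoc 1 j≤k)))
            (cong (λ t → a (suc k) * b t) (ℕₚ.n∸n≡0 k))

⋆-suc-vanishing : ∀ a b k → b 0 ≡ + 0 → (a ⋆ b) (suc k) ≡ (a ⋆ (b ∘ suc)) k
⋆-suc-vanishing a b k b₀≡0 = begin
  (a ⋆ b) (suc k)                          ≡⟨ ⋆-suc a b k ⟩
  (a ⋆ (b ∘ suc)) k + a (suc k) * b 0      ≡⟨ cong (λ x → (a ⋆ (b ∘ suc)) k + a (suc k) * x) b₀≡0 ⟩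
  (a ⋆ (b ∘ suc)) k + a (suc k) * + 0      ≡⟨ cong (λ s → (a ⋆ (b ∘ suc)) k + s) (ℤₚ.*-zeroʳ (a (suc k))) ⟩
  (a ⋆ (b ∘ suc)) k + + 0                  ≡⟨ ℤₚ.+-identityʳ _ ⟩
  (a ⋆ (b ∘ suc)) k                        ∎

defect : (ℕ → ℤ) → ℕ → ℤ
defect u k = u (suc (suc k)) - (+ 6 * u (suc k) - u k)

defect-B : ∀ k → defect B k ≡ + 0
defect-B k = ℤₚ.+-inverseʳ (+ 6 * B (suc k) - B k)

defect-*ˡ : ∀ c u k → defect (λ t → c * u t) k ≡ c * defect u k
defect-*ˡ c u k = identity c (u k) (u (suc k)) (u (suc (suc k)))
  where
  identity : ∀ c x y z → c * z - (+ 6 * (c * y) - c * x) ≡ c * (z - (+ 6 * y - x))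
  identity = solve-∀

⋆-defectʳ : ∀ a b k →
            (a ⋆ defect b) k ≡ (a ⋆ (b ∘ suc ∘ suc)) k - (+ 6 * (a ⋆ (b ∘ suc)) k - (a ⋆ b) k)
⋆-defectʳ a b k = begin
  Σ₁ k (λ j → a j * defect b (k ∸ j))
    ≡⟨ Σ₁-cong k (λ {j} _ → distrib (a j) (b (k ∸ j)) (b (suc (k ∸ j))) (b (suc (suc (k ∸ j))))) ⟩
  Σ₁ k (λ j → z j - (+ 6 * y j - x j))
    ≡⟨ Σ₁-distrib-- k z (λ j → + 6 * y j - x j) ⟩
  Σ₁ k z - Σ₁ k (λ j → + 6 * y j - x j)
    ≡⟨ cong (λ s → Σ₁ k z - s) (trans (Σ₁-distrib-- k (λ j → + 6 * y j) x)
                               (cong (_- Σ₁ k x) (Σ₁-*ˡ k (+ 6) y))) ⟩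
  Σ₁ k z - (+ 6 * Σ₁ k y - Σ₁ k x)
    ∎
  where
  x y z : ℕ → ℤ
  x j = a j * b (k ∸ j)
  y j = a j * b (suc (k ∸ j))
  z j = a j * b (suc (suc (k ∸ j)))
  distrib : ∀ c p q r → c * (r - (+ 6 * q - p)) ≡ c * r - (+ 6 * (c * q) - c * p)
  distrib = solve-∀

defect-⋆ : ∀ a b → b 0 ≡ + 0 → ∀ k → defect (a ⋆ b) k ≡ (a ⋆ defect b) k + a (suc k) * b 1
defect-⋆ a b b₀≡0 k = begin
  (a ⋆ b) (suc (suc k)) - (+ 6 * (a ⋆ b) (suc k) - (a ⋆ b) k)
    ≡⟨ cong₂ (λ p q → p - (+ 6 * q - (a ⋆ b) k)) two-steps (⋆-suc-vanishing a b k b₀≡0) ⟩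
  (a ⋆ (b ∘ suc ∘ suc)) k + a (suc k) * b 1 - (+ 6 * (a ⋆ (b ∘ suc)) k - (a ⋆ b) k)
    ≡⟨ rearrange ((a ⋆ (b ∘ suc ∘ suc)) k) ((a ⋆ (b ∘ suc)) k) ((a ⋆ b) k) (a (suc k) * b 1) ⟩
  (a ⋆ (b ∘ suc ∘ suc)) k - (+ 6 * (a ⋆ (b ∘ suc)) k - (a ⋆ b) k) + a (suc k) * b 1
    ≡⟨ cong (_+ a (suc k) * b 1) (sym (⋆-defectʳ a b k)) ⟩
  (a ⋆ defect b) k + a (suc k) * b 1
    ∎
  where
  two-steps : (a ⋆ b) (suc (suc k)) ≡ (a ⋆ (b ∘ suc ∘ suc)) k + a (suc k) * b 1
  two-steps = trans (⋆-suc-vanishing a b (suc k) b₀≡0) (⋆-suc a (b ∘ suc) k)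
  rearrange : ∀ p q r s → p + s - (+ 6 * q - r) ≡ p - (+ 6 * q - r) + s
  rearrange = solve-∀

recurrence-unique : ∀ {u v : ℕ → ℤ} → u 0 ≡ v 0 → u 1 ≡ v 1 →
                    (∀ k → defect u k ≡ defect v k) → ∀ k → u k ≡ v k
recurrence-unique {u} {v} u₀≡v₀ u₁≡v₁ defect≗ = proj₁ ∘ consecutive
  where
  unfold : ∀ (w : ℕ → ℤ) k → w (suc (suc k)) ≡ defect w k + (+ 6 * w (suc k) - w k)
  unfold w k = identity (w k) (w (suc k)) (w (suc (suc k)))
    where
    identity : ∀ x y z → z ≡ z - (+ 6 * y - x) + (+ 6 * y - x)
    identity = solve-∀

  consecutive : ∀ k → u k ≡ v k × u (suc k) ≡ v (suc k)
  consecutive zero = u₀≡v₀ , u₁≡v₁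
  consecutive (suc k) with consecutive k
  ... | uₖ≡vₖ , uₖ₊₁≡vₖ₊₁ = uₖ₊₁≡vₖ₊₁ , (begin
    u (suc (suc k))                          ≡⟨ unfold u k ⟩
    defect u k + (+ 6 * u (suc k) - u k)     ≡⟨ cong₂ _+_ (defect≗ k)
                                                  (cong₂ (λ y x → + 6 * y - x) uₖ₊₁≡vₖ₊₁ uₖ≡vₖ) ⟩
    defect v k + (+ 6 * v (suc k) - v k)     ≡⟨ sym (unfold v k) ⟩
    v (suc (suc k))                          ∎)

S T : ℕ → ℤ
S = B ⋆ B
T = B ⋆ S

defect-S : ∀ k → defect S k ≡ B (suc k)
defect-S k = begin
  defect S k                         ≡⟨ defect-⋆ B B refl k ⟩
  (B ⋆ defect B) k + B (suc k) * + 1 ≡⟨ cong₂ _+_ (⋆-zeroʳ B k defect-B) (ℤₚ.*-identityʳ (B (suc k))) ⟩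
  + 0 + B (suc k)                    ≡⟨ ℤₚ.+-identityˡ (B (suc k)) ⟩
  B (suc k)                          ∎

defect-T : ∀ k → defect T k ≡ S (suc k)
defect-T k = begin
  defect T k                       ≡⟨ defect-⋆ B S refl k ⟩
  (B ⋆ defect S) k + B (suc k) * S 1 ≡⟨ cong₂ _+_ (⋆-congʳ B k defect-S) (ℤₚ.*-zeroʳ (B (suc k))) ⟩
  (B ⋆ (B ∘ suc)) k + + 0          ≡⟨ ℤₚ.+-identityʳ _ ⟩
  (B ⋆ (B ∘ suc)) k                ≡⟨ sym (⋆-suc-vanishing B B k refl) ⟩
  S (suc k)                        ∎

S-closed T-closed : ℕ → ℤ
S-closed k = + k * B (suc k) - + 3 * + suc k * B k
T-closed k = (+ 8 * (+ k * + k) + + 27 * + k + + 19) * B k - + 9 * + k * B (suc k)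

defect-S-closed : ∀ k → defect S-closed k ≡ + 16 * B (suc k)
defect-S-closed k = identity (+ k) (B k) (B (suc k))
  where
  identity : ∀ K b₀ b₁ → let b₂ = + 6 * b₁ - b₀ ; b₃ = + 6 * b₂ - b₁
                             s = λ K x y → K * y - + 3 * (+ 1 + K) * x
                         in s (+ 2 + K) b₂ b₃ - (+ 6 * s (+ 1 + K) b₁ b₂ - s K b₀ b₁) ≡ + 16 * b₁
  identity = solve-∀

defect-T-closed : ∀ k → defect T-closed k ≡ + 32 * S-closed (suc k)
defect-T-closed k = identity (+ k) (B k) (B (suc k))
  where
  identity : ∀ K b₀ b₁ → let b₂ = + 6 * b₁ - b₀ ; b₃ = + 6 * b₂ - b₁
                             t = λ K x y → (+ 8 * (K * K) + + 27 * K + + 19) * x - + 9 * K * y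
                         in t (+ 2 + K) b₂ b₃ - (+ 6 * t (+ 1 + K) b₁ b₂ - t K b₀ b₁)
                            ≡ + 32 * ((+ 1 + K) * b₂ - + 3 * (+ 2 + K) * b₁)
  identity = solve-∀

S-closed-form : ∀ k → + 16 * S k ≡ S-closed k
S-closed-form = recurrence-unique refl refl λ k → begin
  defect (λ t → + 16 * S t) k ≡⟨ defect-*ˡ (+ 16) S k ⟩
  + 16 * defect S k           ≡⟨ cong (+ 16 *_) (defect-S k) ⟩
  + 16 * B (suc k)            ≡⟨ sym (defect-S-closed k) ⟩
  defect S-closed k           ∎

T-closed-form : ∀ k → + 512 * T k ≡ T-closed k
T-closed-form = recurrence-unique refl refl λ k → begin
  defect (λ t → + 512 * T t) k ≡⟨ defect-*ˡ (+ 512) T k ⟩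
  + 512 * defect T k           ≡⟨ cong (+ 512 *_) (defect-T k) ⟩
  + 512 * S (suc k)            ≡⟨ ℤₚ.*-assoc (+ 32) (+ 16) (S (suc k)) ⟩
  + 32 * (+ 16 * S (suc k))    ≡⟨ cong (+ 32 *_) (S-closed-form (suc k)) ⟩
  + 32 * S-closed (suc k)      ≡⟨ sym (defect-T-closed k) ⟩
  defect T-closed k            ∎

-- A failing guard means j₁ + j₂ ≥ m, so the dropped term has the factor B 0 = 0.
tripleSum-guard-redundant : ∀ m j₁ j₂ →
  (if suc (j₁ ℕ.+ j₂) ≤ᵇ m then B j₁ * B j₂ * B (m ∸ j₁ ∸ j₂) else + 0) ≡ B j₁ * B j₂ * B (m ∸ j₁ ∸ j₂)
tripleSum-guard-redundant m j₁ j₂ with suc (j₁ ℕ.+ j₂) ≤ᵇ m | ℕₚ.≤ᵇ-reflects-≤ (suc (j₁ ℕ.+ j₂)) m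
... | true  | _          = refl
... | false | ofⁿ guard≰ = sym (begin
  B j₁ * B j₂ * B (m ∸ j₁ ∸ j₂) ≡⟨ cong (λ t → B j₁ * B j₂ * B t) m∸j₁∸j₂≡0 ⟩
  B j₁ * B j₂ * + 0             ≡⟨ ℤₚ.*-zeroʳ (B j₁ * B j₂) ⟩
  + 0                           ∎)
  where
  m∸j₁∸j₂≡0 : m ∸ j₁ ∸ j₂ ≡ 0
  m∸j₁∸j₂≡0 = trans (ℕₚ.∸-+-assoc m j₁ j₂) (ℕₚ.m≤n⇒m∸n≡0 (ℕₚ.≤-pred (ℕₚ.≰⇒> guard≰)))

tripleSum≡T : ∀ m → tripleSum m ≡ T m
tripleSum≡T m = begin
  tripleSum m
    ≡⟨ Σ₁-cong m (λ {j₁} _ → Σ₁-cong m (λ {j₂} _ → tripleSum-guard-redundant m j₁ j₂)) ⟩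
  Σ₁ m (λ j₁ → Σ₁ m (λ j₂ → B j₁ * B j₂ * B (m ∸ j₁ ∸ j₂)))
    ≡⟨ Σ₁-cong m (λ {j₁} _ → inner j₁) ⟩
  T m ∎
  where
  inner : ∀ j₁ → Σ₁ m (λ j₂ → B j₁ * B j₂ * B (m ∸ j₁ ∸ j₂)) ≡ B j₁ * S (m ∸ j₁)
  inner j₁ = begin
    Σ₁ m (λ j₂ → B j₁ * B j₂ * B (m ∸ j₁ ∸ j₂))
      ≡⟨ Σ₁-cong m (λ {j₂} _ → ℤₚ.*-assoc (B j₁) (B j₂) (B (m ∸ j₁ ∸ j₂))) ⟩
    Σ₁ m (λ j₂ → B j₁ * (B j₂ * B (m ∸ j₁ ∸ j₂)))
      ≡⟨ Σ₁-*ˡ m (B j₁) (λ j₂ → B j₂ * B (m ∸ j₁ ∸ j₂)) ⟩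
    B j₁ * Σ₁ m (λ j₂ → B j₂ * B (m ∸ j₁ ∸ j₂))
      ≡⟨ cong (B j₁ *_) (⋆-extend B B refl (ℕₚ.m∸n≤m m j₁)) ⟩
    B j₁ * S (m ∸ j₁) ∎

2*nC2≡n*[n∸1] : ∀ n → 2 ℕ.* (n C 2) ≡ n ℕ.* (n ∸ 1)
2*nC2≡n*[n∸1] zero          = refl
2*nC2≡n*[n∸1] (suc zero)    = refl
2*nC2≡n*[n∸1] (suc (suc n)) = begin
  2 ℕ.* (suc (suc n) C 2)              ≡⟨ cong (2 ℕ.*_) (sym (nCk+nC[k+1]≡[n+1]C[k+1] (suc n) 1)) ⟩
  2 ℕ.* (suc n C 1 ℕ.+ suc n C 2)      ≡⟨ ℕₚ.*-distribˡ-+ 2 (suc n C 1) (suc n C 2) ⟩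
  2 ℕ.* (suc n C 1) ℕ.+ 2 ℕ.* (suc n C 2)
    ≡⟨ cong₂ (λ p q → 2 ℕ.* p ℕ.+ q) (nC1≡n (suc n)) (2*nC2≡n*[n∸1] (suc n)) ⟩
  2 ℕ.* suc n ℕ.+ suc n ℕ.* n          ≡⟨ identity n ⟩
  suc (suc n) ℕ.* suc n                ∎
  where
  identity : ∀ n → 2 ℕ.* suc n ℕ.+ suc n ℕ.* n ≡ suc (suc n) ℕ.* suc n
  identity = ℕ-Solver.solve-∀

n*[n∸1]≡2*nC2 : ∀ n → + n * + (n ∸ 1) ≡ + 2 * + (n C 2)
n*[n∸1]≡2*nC2 n = begin
  + n * + (n ∸ 1)      ≡⟨ ℤₚ.pos-* n (n ∸ 1) ⟨
  + (n ℕ.* (n ∸ 1))    ≡⟨ cong +_ (2*nC2≡n*[n∸1] n) ⟨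
  + (2 ℕ.* (n C 2))    ≡⟨ ℤₚ.pos-* 2 (n C 2) ⟩
  + 2 * + (n C 2)      ∎

alternating : (ℕ → ℤ) → ℕ → ℤ
alternating f m = + 1 * f (6 ℕ.+ m) - + 3 * f (4 ℕ.+ m) + + 3 * f (2 ℕ.+ m) - + 1 * f m

alternating-cong : ∀ {f g : ℕ → ℤ} → (∀ k → f k ≡ g k) → ∀ m → alternating f m ≡ alternating g m
alternating-cong f≗g m =
  cong₂ _-_ (cong₂ _+_ (cong₂ _-_ (cong (+ 1 *_) (f≗g _)) (cong (+ 3 *_) (f≗g _)))
                       (cong (+ 3 *_) (f≗g _)))
            (cong (+ 1 *_) (f≗g _))

alternating-*ˡ : ∀ c f m → c * alternating f m ≡ alternating (λ k → c * f k) m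
alternating-*ˡ c f m = identity c (f (6 ℕ.+ m)) (f (4 ℕ.+ m)) (f (2 ℕ.+ m)) (f m)
  where
  identity : ∀ c w x y z → c * (+ 1 * w - + 3 * x + + 3 * y - + 1 * z)
                         ≡ + 1 * (c * w) - + 3 * (c * x) + + 3 * (c * y) - + 1 * (c * z)
  identity = solve-∀

alternating-T-closed : ∀ m → alternating T-closed m
  ≡ + 256 * (+ (5 ℕ.+ m) * + (4 ℕ.+ m) * B (4 ℕ.+ m) - + (2 ℕ.+ m) * + (1 ℕ.+ m) * B (2 ℕ.+ m))
alternating-T-closed m = identity (+ m) (B m) (B (suc m))
  where
  identity : ∀ K b₀ b₁ →
    let b₂ = + 6 * b₁ - b₀ ; b₃ = + 6 * b₂ - b₁ ; b₄ = + 6 * b₃ - b₂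
        b₅ = + 6 * b₄ - b₃ ; b₆ = + 6 * b₅ - b₄ ; b₇ = + 6 * b₆ - b₅
        t = λ K x y → (+ 8 * (K * K) + + 27 * K + + 19) * x - + 9 * K * y
    in + 1 * t (+ 6 + K) b₆ b₇ - + 3 * t (+ 4 + K) b₄ b₅ + + 3 * t (+ 2 + K) b₂ b₃ - + 1 * t K b₀ b₁
       ≡ + 256 * ((+ 5 + K) * (+ 4 + K) * b₄ - (+ 2 + K) * (+ 1 + K) * b₂)
  identity = solve-∀

alternating-T : ∀ m → alternating T m
              ≡ + ((5 ℕ.+ m) C 2) * B (4 ℕ.+ m) - + ((2 ℕ.+ m) C 2) * B (2 ℕ.+ m)
alternating-T m = ℤₚ.*-cancelˡ-≡ (+ 512) _ _ (begin
  + 512 * alternating T m                 ≡⟨ alternating-*ˡ (+ 512) T m ⟩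
  alternating (λ k → + 512 * T k) m       ≡⟨ alternating-cong T-closed-form m ⟩
  alternating T-closed m                  ≡⟨ alternating-T-closed m ⟩
  + 256 * (+ (5 ℕ.+ m) * + (4 ℕ.+ m) * B (4 ℕ.+ m) - + (2 ℕ.+ m) * + (1 ℕ.+ m) * B (2 ℕ.+ m))
    ≡⟨ cong₂ (λ p q → + 256 * (p * B (4 ℕ.+ m) - q * B (2 ℕ.+ m)))
             (n*[n∸1]≡2*nC2 (5 ℕ.+ m)) (n*[n∸1]≡2*nC2 (2 ℕ.+ m)) ⟩
  + 256 * (+ 2 * c₅ * B (4 ℕ.+ m) - + 2 * c₂ * B (2 ℕ.+ m))
    ≡⟨ identity c₅ c₂ (B (4 ℕ.+ m)) (B (2 ℕ.+ m)) ⟩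
  + 512 * (c₅ * B (4 ℕ.+ m) - c₂ * B (2 ℕ.+ m)) ∎)
  where
  c₅ = + ((5 ℕ.+ m) C 2)
  c₂ = + ((2 ℕ.+ m) C 2)
  identity : ∀ c c′ x y → + 256 * (+ 2 * c * x - + 2 * c′ * y) ≡ + 512 * (c * x - c′ * y)
  identity = solve-∀

theorem2 : (n : ℕ) → 4 ≤ n →
    (+ (3 C 0)) * tripleSum n - (+ (3 C 1)) * tripleSum (n ∸ 2)
      + (+ (3 C 2)) * tripleSum (n ∸ 4) - (+ (3 C 3)) * tripleSum (n ∸ 6)
    ≡ (+ ((n ∸ 1) C 2)) * B (n ∸ 2) - (+ ((n ∸ 4) C 2)) * B (n ∸ 4)
theorem2 0 ()
theorem2 1 (s≤s ())
theorem2 2 (s≤s (s≤s ()))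
theorem2 3 (s≤s (s≤s (s≤s ())))
theorem2 4 _ = refl
theorem2 5 _ = refl
theorem2 (suc (suc (suc (suc (suc (suc m)))))) _ =
  trans (alternating-cong tripleSum≡T m) (alternating-T m)
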